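{- Let $S$ be an additive abelian semigroup and let $(A_q)_{q=1}^{\infty}$ be a decreasing sequence of subsets of $S$ (i.e. $A_q \supseteq A_{q+1}$ for all $q$), and let $A = \bigcap_{q=1}^{\infty} A_q$. If $A$ is a basis of order $h_0$ for $S$, then \[ h_0A = \bigcap_{q=1}^{\infty} h_0A_q. \] If moreover the semigroup $S$ contains an additive identity and $A$ is a basis of order $h_0$ for $S$, then \[ hA = \bigcap_{q=1}^{\infty} hA_q \] for all integers $h \geq h_0$.
   Context: For a subset $A$ of an additive abelian semigroup $S$ and a positive integer $h$, $hA = \{a_1+\cdots+a_h : a_i \in A \text{ for all } i\}$ is the $h$-fold sumset. $A$ is a basis of order $h$ for $S$ if $hA = S$. -}

module Defs where

open import Level using (Level; _⊔_)
open import Data.Nat using (ℕ; zero; suc)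
open import Data.Fin using (Fin)
open import Data.Product using (Σ; ∃; _×_; _,_)
open import Relation.Unary using (Pred)
open import Algebra.Bundles using (CommutativeSemigroup)

module _ {c ℓ : Level} (S : CommutativeSemigroup c ℓ) where
  open CommutativeSemigroup S

  sumFin : ∀ n → (Fin (suc n) → Carrier) → Carrier
  sumFin zero    a = a Fin.zero
    where import Data.Fin as Fin
  sumFin (suc n) a = a Fin.zero ∙ sumFin n (λ i → a (Fin.suc i))
    where import Data.Fin as Fin

  sumset : ∀ {p} → ℕ → Pred Carrier p → Pred Carrier (c ⊔ ℓ ⊔ p)
  sumset zero    A x = Data.Empty.Polymorphic.⊥
    where import Data.Empty.Polymorphic
  sumset (suc n) A x =
    Σ (Fin (suc n) → Carrier) λ a → ((i : Fin (suc n)) → A (a i)) × (sumFin n a ≈ x)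

  IsBasis : ∀ {p} → ℕ → Pred Carrier p → Set (c ⊔ ℓ ⊔ p)
  IsBasis h A = ∀ x → sumset h A x

  HasIdentity : Set (c ⊔ ℓ)
  HasIdentity = Σ Carrier λ e → ∀ x → ((e ∙ x) ≈ x) × ((x ∙ e) ≈ x)

{-# OPTIONS --safe #-}
-- Once A is a basis of order h₀, both sides of the first identity are all of S, and the
-- same holds for every h ≥ h₀ because, given an identity 0, a basis of order h is also
-- one of order h + 1: writing 0 = a + t with a ∈ A, every x equals a + (t + x) with
-- t + x ∈ hA.
module Submission where

open import Defs
open import Level using (Level)
open import Data.Nat using (ℕ; suc; zero; _≤_; _≤′_; ≤′-refl; ≤′-step)
open import Data.Nat.Properties using (≤⇒≤′)
open import Data.Fin as Fin using (Fin)
open import Data.Vec.Functional using (_∷_; head; tail)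
open import Data.Product using (Σ; _×_; _,_; proj₁; proj₂)
open import Data.Empty.Polymorphic using (⊥-elim)
open import Relation.Unary using (Pred; _⊇_; _⊆_; _≐_; ⋂)
open import Algebra.Bundles using (CommutativeSemigroup)

module _ {c ℓ : Level} (S : CommutativeSemigroup c ℓ) where
  open CommutativeSemigroup S
  open import Relation.Binary.Reasoning.Setoid setoid

  private variable
    p : Level
    A B : Pred Carrier p

  sumset-mono : ∀ n → A ⊆ B → sumset S n A ⊆ sumset S n B
  sumset-mono (suc n) A⊆B (a , a∈A , sum≈x) = a , (λ i → A⊆B (a∈A i)) , sum≈x

  sumset-resp-≈ : ∀ n {x y} → x ≈ y → sumset S n A x → sumset S n A y
  sumset-resp-≈ (suc n) x≈y (a , a∈A , sum≈x) = a , a∈A , trans sum≈x x≈y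

  sumset-∙ˡ : ∀ n {a y} → A a → sumset S (suc n) A y → sumset S (suc (suc n)) A (a ∙ y)
  sumset-∙ˡ {A = A} n {a} a∈A (b , b∈A , sum≈y) = a ∷ b , a∷b∈A , ∙-congˡ sum≈y
    where
      a∷b∈A : (i : Fin (suc (suc n))) → A ((a ∷ b) i)
      a∷b∈A Fin.zero    = a∈A
      a∷b∈A (Fin.suc i) = b∈A i

  sumset-∙-factor : HasIdentity S → ∀ n {x} → sumset S (suc n) A x →
                    Σ Carrier λ a → A a × Σ Carrier λ t → a ∙ t ≈ x
  sumset-∙-factor (e , identity) zero (a , a∈A , a₀≈x) =
    head a , a∈A Fin.zero , e , trans (proj₂ (identity (head a))) a₀≈x
  sumset-∙-factor _ (suc n) (a , a∈A , sum≈x) =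
    head a , a∈A Fin.zero , sumFin S n (tail a) , sum≈x

  IsBasis-suc : HasIdentity S → ∀ n → IsBasis S n A → IsBasis S (suc n) A
  IsBasis-suc _ zero basis x = ⊥-elim (basis x)
  IsBasis-suc {A = A} (e , identity) (suc n) basis x
    with a , a∈A , t , a∙t≈e ← sumset-∙-factor {A = A} (e , identity) n (basis e) =
    sumset-resp-≈ {A = A} (suc (suc n)) a∙[t∙x]≈x (sumset-∙ˡ {A = A} n a∈A (basis (t ∙ x)))
    where
      a∙[t∙x]≈x : a ∙ (t ∙ x) ≈ x
      a∙[t∙x]≈x = begin
        a ∙ (t ∙ x) ≈⟨ assoc a t x ⟨
        (a ∙ t) ∙ x ≈⟨ ∙-congʳ a∙t≈e ⟩
        e ∙ x       ≈⟨ proj₁ (identity x) ⟩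
        x           ∎

  IsBasis-≤ : HasIdentity S → ∀ {h₀ h} → h₀ ≤ h → IsBasis S h₀ A → IsBasis S h A
  IsBasis-≤ {A = A} identity h₀≤h basis = go (≤⇒≤′ h₀≤h)
    where
      go : ∀ {h} → _ ≤′ h → IsBasis S h A
      go ≤′-refl              = basis
      go (≤′-step {h} h₀≤′h) = IsBasis-suc identity h (go h₀≤′h)

  basis-sumset-⋂ : ∀ {i} {I : Set i} h (A : I → Pred Carrier p) → IsBasis S h (⋂ I A) →
                   sumset S h (⋂ I A) ≐ ⋂ I (λ q → sumset S h (A q))
  basis-sumset-⋂ h A basis = (λ x∈hA q → sumset-mono h (λ a∈A → a∈A q) x∈hA) , (λ {x} _ → basis x)

mainTheorem3 : ∀ {c ℓ p : Level} (S : CommutativeSemigroup c ℓ)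
    (Aq : ℕ → Pred (CommutativeSemigroup.Carrier S) p) →
    (∀ q → Aq q ⊇ Aq (suc q)) →
    (h₀ : ℕ) → 1 ≤ h₀ →
    IsBasis S h₀ (λ x → ∀ q → Aq q x) →
    (sumset S h₀ (λ x → ∀ q → Aq q x) ≐ (λ x → ∀ q → sumset S h₀ (Aq q) x))
    × (HasIdentity S → ∀ h → h₀ ≤ h →
    sumset S h (λ x → ∀ q → Aq q x) ≐ (λ x → ∀ q → sumset S h (Aq q) x))
mainTheorem3 S Aq _ h₀ _ basis =
  basis-sumset-⋂ S h₀ Aq basis ,
  λ identity h h₀≤h → basis-sumset-⋂ S h Aq (IsBasis-≤ S identity h₀≤h basis)
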